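{- Let $(A,\rightarrow,\rightsquigarrow,1)$ be a pseudo-BE algebra and $\varphi$ a pseudo-valuation on $A$. Then $\varphi$ is commutative if and only if for all $x,y,z\in A$: $(cpv_3)$ $\varphi(x\vee_1 y\rightarrow x)\le\varphi(z\rightarrow(y\rightarrow x))+\varphi(z)$ and $(cpv_4)$ $\varphi(x\vee_2 y\rightsquigarrow x)\le\varphi(z\rightsquigarrow(y\rightsquigarrow x))+\varphi(z)$.
   Context: A pseudo-BE algebra is an algebra $(A,\rightarrow,\rightsquigarrow,1)$ of type $(2,2,0)$ such that for all $x,y,z\in A$: $x\rightarrow x=x\rightsquigarrow x=1$; $x\rightarrow 1=x\rightsquigarrow 1=1$; $1\rightarrow x=1\rightsquigarrow x=x$; $x\rightarrow(y\rightsquigarrow z)=y\rightsquigarrow(x\rightarrow z)$; $x\rightarrow y=1$ iff $x\rightsquigarrow y=1$. Put $x\vee_1 y=(x\rightarrow y)\rightsquigarrow y$, $x\vee_2 y=(x\rightsquigarrow y)\rightarrow y$; $x\vee_1 y\rightarrow x$ means $(x\vee_1 y)\rightarrow x$. A pseudo-valuation on $A$ is a map $\varphi:A\to\mathbb{R}$ with $\varphi(1)=0$ and $\varphi(y)-\varphi(x)\le\min\{\varphi(x\rightarrow y),\varphi(x\rightsquigarrow y)\}$ for all $x,y$. It is commutative if for all $x,y$: $\varphi((x\vee_1 y)\rightarrow x)\le\varphi(y\rightarrow x)$ and $\varphi((x\vee_2 y)\rightsquigarrow x)\le\varphi(y\rightsquigarrow x)$. -}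

module Defs where

open import Level using (Level; _⊔_; suc)
open import Relation.Binary.PropositionalEquality using (_≡_)
open import Data.Product using (_×_)
open import Data.Sum using (_⊎_)

-- We replace ℝ (with + , - , 0 , ≤)
-- by an arbitrary totally ordered abelian group; ℝ is an instance, so the
-- theorem stated for all such groups implies the real-valued statement.
record OrderedAbelianGroup (c ℓ : Level) : Set (suc (c ⊔ ℓ)) where
  infixl 6 _+_ _-_
  infix  8 -_
  infix  4 _≤_
  field
    Carrier  : Set c
    _+_      : Carrier → Carrier → Carrier
    0#       : Carrier
    -_       : Carrier → Carrier
    _≤_      : Carrier → Carrier → Set ℓ
    +-assoc  : ∀ x y z → (x + y) + z ≡ x + (y + z)
    +-comm   : ∀ x y → x + y ≡ y + x
    +-identityˡ : ∀ x → 0# + x ≡ x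
    -‿inverseˡ : ∀ x → (- x) + x ≡ 0#
    ≤-refl   : ∀ x → x ≤ x
    ≤-trans  : ∀ {x y z} → x ≤ y → y ≤ z → x ≤ z
    ≤-antisym : ∀ {x y} → x ≤ y → y ≤ x → x ≡ y
    ≤-total  : ∀ x y → x ≤ y ⊎ y ≤ x
    +-monoˡ-≤ : ∀ {x y} z → x ≤ y → x + z ≤ y + z

  _-_ : Carrier → Carrier → Carrier
  x - y = x + (- y)


record PseudoBE (a : Level) : Set (suc a) where
  infixr 5 _⇒_ _⇝_
  field
    Carrier : Set a
    _⇒_     : Carrier → Carrier → Carrier
    _⇝_     : Carrier → Carrier → Carrier
    𝟙       : Carrier
    ⇒-refl  : ∀ x → x ⇒ x ≡ 𝟙
    ⇝-refl  : ∀ x → x ⇝ x ≡ 𝟙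
    ⇒-top   : ∀ x → x ⇒ 𝟙 ≡ 𝟙
    ⇝-top   : ∀ x → x ⇝ 𝟙 ≡ 𝟙
    ⇒-identity : ∀ x → 𝟙 ⇒ x ≡ x
    ⇝-identity : ∀ x → 𝟙 ⇝ x ≡ x
    exchange : ∀ x y z → x ⇒ (y ⇝ z) ≡ y ⇝ (x ⇒ z)
    ⇒⇝-one  : ∀ x y → (x ⇒ y ≡ 𝟙 → x ⇝ y ≡ 𝟙) × (x ⇝ y ≡ 𝟙 → x ⇒ y ≡ 𝟙)

  _∨₁_ : Carrier → Carrier → Carrier
  x ∨₁ y = (x ⇒ y) ⇝ y

  _∨₂_ : Carrier → Carrier → Carrier
  x ∨₂ y = (x ⇝ y) ⇒ y

module _ {a c ℓ : Level} (A : PseudoBE a) (G : OrderedAbelianGroup c ℓ) where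
  open PseudoBE A
  open OrderedAbelianGroup G renaming (Carrier to R)

  -- φ(y) - φ(x) ≤ min{φ(x→y), φ(x⇝y)}, written as the conjunction of both bounds
  IsPseudoValuation : (Carrier → R) → Set (a ⊔ c ⊔ ℓ)
  IsPseudoValuation φ =
    (φ 𝟙 ≡ 0#) ×
    (∀ x y → (φ y - φ x ≤ φ (x ⇒ y)) × (φ y - φ x ≤ φ (x ⇝ y)))

  IsCommutativePV : (Carrier → R) → Set (a ⊔ ℓ)
  IsCommutativePV φ =
    ∀ x y → (φ ((x ∨₁ y) ⇒ x) ≤ φ (y ⇒ x)) × (φ ((x ∨₂ y) ⇝ x) ≤ φ (y ⇝ x))

module Submission where

-- A pseudo-valuation φ satisfies the "triangle inequality"
-- φ(b) ≤ φ(a → b) + φ(a) (and likewise for ⇝), which is just the defining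
-- bound φ(b) - φ(a) ≤ φ(a → b) with φ(a) moved to the right.  Moreover
-- φ(a → a) = φ(1) = 0.
--   (⇒) Commutativity bounds φ((x ∨₁ y) → x) by φ(y → x), and the triangle
--       inequality with a := z, b := y → x bounds φ(y → x) by
--       φ(z → (y → x)) + φ(z); similarly for ∨₂ and ⇝.
--   (⇐) Instantiate z := y → x (resp. y ⇝ x); the right-hand side becomes
--       φ((y → x) → (y → x)) + φ(y → x) = 0 + φ(y → x).

open import Defs
open import Level using (_⊔_)
open import Data.Product using (_×_; _,_; proj₁; proj₂)
open import Function.Bundles using (_⇔_; mk⇔)
open import Relation.Binary.PropositionalEquality
  using (_≡_; cong; subst; module ≡-Reasoning)

module OrderedAbelianGroupProperties {c ℓ} (G : OrderedAbelianGroup c ℓ) where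
  open OrderedAbelianGroup G

  minus-plus : ∀ a b → (a - b) + b ≡ a
  minus-plus a b = begin
    (a + - b) + b   ≡⟨ +-assoc a (- b) b ⟩
    a + (- b + b)   ≡⟨ cong (a +_) (-‿inverseˡ b) ⟩
    a + 0#          ≡⟨ +-comm a 0# ⟩
    0# + a          ≡⟨ +-identityˡ a ⟩
    a               ∎
    where open ≡-Reasoning

  minus-≤⇒≤-plus : ∀ {a b c} → a - b ≤ c → a ≤ c + b
  minus-≤⇒≤-plus {a} {b} {c} a-b≤c =
    subst (_≤ c + b) (minus-plus a b) (+-monoˡ-≤ b a-b≤c)

module PseudoValuationProperties
  {a c ℓ} (A : PseudoBE a) (G : OrderedAbelianGroup c ℓ)
  {φ : PseudoBE.Carrier A → OrderedAbelianGroup.Carrier G}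
  (isPV : IsPseudoValuation A G φ) where

  open PseudoBE A
  open OrderedAbelianGroup G renaming (Carrier to R)
  open OrderedAbelianGroupProperties G

  φ𝟙≡0 : φ 𝟙 ≡ 0#
  φ𝟙≡0 = proj₁ isPV

  ⇒-triangle : ∀ x y → φ y ≤ φ (x ⇒ y) + φ x
  ⇒-triangle x y = minus-≤⇒≤-plus (proj₁ (proj₂ isPV x y))

  ⇝-triangle : ∀ x y → φ y ≤ φ (x ⇝ y) + φ x
  ⇝-triangle x y = minus-≤⇒≤-plus (proj₂ (proj₂ isPV x y))

  -- Adding φ(u ∘ u) changes nothing, since u ∘ u = 1 and φ(1) = 0; stated for
  -- any binary operation ∘ with u ∘ u = 1, to be used with both ⇒ and ⇝.
  φ-refl-+ : (_∘_ : Carrier → Carrier → Carrier) → (∀ u → u ∘ u ≡ 𝟙) →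
             ∀ u v → φ (u ∘ u) + v ≡ v
  φ-refl-+ _∘_ ∘-refl u v = begin
    φ (u ∘ u) + v   ≡⟨ cong (λ t → φ t + v) (∘-refl u) ⟩
    φ 𝟙 + v         ≡⟨ cong (_+ v) φ𝟙≡0 ⟩
    0# + v          ≡⟨ +-identityˡ v ⟩
    v               ∎
    where open ≡-Reasoning

theorem6p12 : ∀ {a c ℓ} (A : PseudoBE a) (G : OrderedAbelianGroup c ℓ)
    (φ : PseudoBE.Carrier A → OrderedAbelianGroup.Carrier G) →
    IsPseudoValuation A G φ →
    IsCommutativePV A G φ ⇔
      (∀ x y z →
        (OrderedAbelianGroup._≤_ G
          (φ (PseudoBE._⇒_ A (PseudoBE._∨₁_ A x y) x))
          (OrderedAbelianGroup._+_ G (φ (PseudoBE._⇒_ A z (PseudoBE._⇒_ A y x))) (φ z)))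
        ×
        (OrderedAbelianGroup._≤_ G
          (φ (PseudoBE._⇝_ A (PseudoBE._∨₂_ A x y) x))
          (OrderedAbelianGroup._+_ G (φ (PseudoBE._⇝_ A z (PseudoBE._⇝_ A y x))) (φ z))))
theorem6p12 {a} {c} {ℓ} A G φ isPV = mk⇔ commutative⇒cpv cpv⇒commutative
  where
  open PseudoBE A
  open OrderedAbelianGroup G renaming (Carrier to R)
  open PseudoValuationProperties A G isPV

  CPV₃₄ : Set (a ⊔ ℓ)
  CPV₃₄ = ∀ x y z →
    (φ ((x ∨₁ y) ⇒ x) ≤ φ (z ⇒ (y ⇒ x)) + φ z) ×
    (φ ((x ∨₂ y) ⇝ x) ≤ φ (z ⇝ (y ⇝ x)) + φ z)

  commutative⇒cpv : IsCommutativePV A G φ → CPV₃₄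
  commutative⇒cpv comm x y z =
    ≤-trans (proj₁ (comm x y)) (⇒-triangle z (y ⇒ x)) ,
    ≤-trans (proj₂ (comm x y)) (⇝-triangle z (y ⇝ x))

  cpv⇒commutative : CPV₃₄ → IsCommutativePV A G φ
  cpv⇒commutative cpv x y =
    subst (φ ((x ∨₁ y) ⇒ x) ≤_) (φ-refl-+ _⇒_ ⇒-refl (y ⇒ x) (φ (y ⇒ x)))
      (proj₁ (cpv x y (y ⇒ x))) ,
    subst (φ ((x ∨₂ y) ⇝ x) ≤_) (φ-refl-+ _⇝_ ⇝-refl (y ⇝ x) (φ (y ⇝ x)))
      (proj₂ (cpv x y (y ⇝ x)))
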